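{- Let \(G=(V,E)\) be a graph on \(n\) vertices, \((T,\mathcal{X})\) a tree decomposition of \(G\) with \(\mathcal{X}=(X^i)_{i\in V(T)}\), and \(P\subseteq T\) a path with node set \(V_P\) and ends \(i_0\), \(j_0\), where \(i_0\) is a nonredundant end of \(P\). With the sets \(R_i,S_i\) defined below: a) the sets \(R_i\) (\(i\in V_P\)) and \(S_i\) (\(i\in V_P\)) are pairwise disjoint and their union is \(V\); b) \(R_i\neq\emptyset\) for all \(i\in V_P\).
   Context: A tree decomposition of \(G\) is a pair \((T,\mathcal{X})\) with \(T\) a tree and \(X^i\subseteq V\) such that every vertex lies in some \(X^i\), every edge is contained in some \(X^i\), and \(X^i\cap X^j\subseteq X^h\) whenever \(h\) lies on the \(i\)–\(j\) path in \(T\). For a path \(P=(i_0,i_1,\dots,i_\ell)\subseteq T\), \(i_0\) is a nonredundant end if \(X^{i_0}\neq\emptyset\) and, when \(\ell\neq0\), \(X^{i_h}\not\subseteq X^{i_{h-1}}\) for all \(h\in\{1,\dots,\ell\}\). For \(i\in V_P\), \(T_i\) is the connected component of \(T-E(P)\) containing \(i\). Let \(R:=\bigcup_{i\in V_P}X^i\) and \(S:=V\setminus R\). For \(x\in R\), its path node is the node \(i\in V_P\) closest to \(i_0\) (along \(P\)) with \(x\in X^i\). For \(i\in V_P\), \(R_i:=\{x\in X^i: i\text{ is the path node of }x\}\) and \(S_i:=\bigcup_{j\in V(T_i)}X^j\setminus R\). -}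

module Defs where

open import Data.Nat using (ℕ; suc; _≤_)
open import Data.Fin using (Fin; inject₁; _<_) renaming (suc to fsuc)
open import Data.Fin.Subset using (Subset; _∈_; _∉_; _⊆_; Nonempty)
open import Data.List using (List; []; _∷_; length; head; last)
open import Data.List.Relation.Unary.Unique.Propositional using (Unique)
open import Data.List.Membership.Propositional using () renaming (_∈_ to _∈ₗ_)
open import Data.Maybe using (just)
open import Data.Product using (Σ; ∃; _×_; _,_)
open import Data.Sum using (_⊎_; inj₁; inj₂)
open import Data.Empty using (⊥)
open import Data.Unit using (⊤)
open import Relation.Nullary using (¬_)
open import Relation.Binary.PropositionalEquality using (_≡_; _≢_)
open import Function using (Injective)

record Graph (n : ℕ) : Set₁ where
  field
    Adj   : Fin n → Fin n → Set
    sym   : ∀ {x y} → Adj x y → Adj y x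
    irref : ∀ {x} → ¬ Adj x x
open Graph public

Chain : {m : ℕ} → (Fin m → Fin m → Set) → List (Fin m) → Set
Chain A []           = ⊥
Chain A (x ∷ [])     = ⊤
Chain A (x ∷ y ∷ xs) = A x y × Chain A (y ∷ xs)

IsPathBetween : {m : ℕ} → (Fin m → Fin m → Set) → Fin m → Fin m → List (Fin m) → Set
IsPathBetween A u v ps = Chain A ps × Unique ps × (head ps ≡ just u) × (last ps ≡ just v)

HasCycle : {m : ℕ} → Graph m → Set
HasCycle G = Σ _ λ ps → Σ _ λ u → Σ _ λ v →
  IsPathBetween (Adj G) u v ps × (3 ≤ length ps) × Adj G v u

IsTree : {m : ℕ} → Graph m → Set
IsTree G = (∀ u v → ∃ λ ps → IsPathBetween (Adj G) u v ps) × ¬ HasCycle G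

record TreeDecomposition {n : ℕ} (G : Graph n) (m : ℕ) : Set₁ where
  field
    T      : Graph m
    isTree : IsTree T
    X      : Fin m → Subset n
    cover-vertices : ∀ x → ∃ λ i → x ∈ X i
    cover-edges    : ∀ x y → Adj G x y → ∃ λ i → x ∈ X i × y ∈ X i
    coherence : ∀ i j h ps → IsPathBetween (Adj T) i j ps → h ∈ₗ ps →
                ∀ x → x ∈ X i → x ∈ X j → x ∈ X h
open TreeDecomposition public

record PathIn {m : ℕ} (T : Graph m) (ℓ : ℕ) : Set where
  field
    node : Fin (suc ℓ) → Fin m
    inj  : Injective _≡_ _≡_ node
    adj  : ∀ (h : Fin ℓ) → Adj T (node (inject₁ h)) (node (fsuc h))
open PathIn public

module _ {n m ℓ : ℕ} {G : Graph n} (D : TreeDecomposition G m) (P : PathIn (T D) ℓ) where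

  NonredundantEnd : Set
  NonredundantEnd = Nonempty (X D (node P Data.Fin.zero)) ×
    (∀ (h : Fin ℓ) → ¬ (X D (node P (fsuc h)) ⊆ X D (node P (inject₁ h))))

  PathEdge : Fin m → Fin m → Set
  PathEdge a b = ∃ λ (h : Fin ℓ) →
    (a ≡ node P (inject₁ h) × b ≡ node P (fsuc h)) ⊎
    (b ≡ node P (inject₁ h) × a ≡ node P (fsuc h))

  AdjMinus : Fin m → Fin m → Set
  AdjMinus a b = Adj (T D) a b × ¬ PathEdge a b

  InComponent : Fin m → Fin m → Set
  InComponent i j = ∃ λ ps → IsPathBetween AdjMinus i j ps

  InR : Fin n → Set
  InR x = ∃ λ (h : Fin (suc ℓ)) → x ∈ X D (node P h)

  -- R_{i_h}: vertices of X^{i_h} whose path node is i_h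
  -- (i.e. i_h is the node of P closest to i₀ whose bag contains x)
  InRᵢ : Fin (suc ℓ) → Fin n → Set
  InRᵢ h x = x ∈ X D (node P h) × (∀ (h' : Fin (suc ℓ)) → h' < h → x ∉ X D (node P h'))

  InSᵢ : Fin (suc ℓ) → Fin n → Set
  InSᵢ h x = (∃ λ j → InComponent (node P h) j × x ∈ X D j) × ¬ InR x

  Family : Fin (suc ℓ) ⊎ Fin (suc ℓ) → Fin n → Set
  Family (inj₁ h) = InRᵢ h
  Family (inj₂ h) = InSᵢ h

-- Two facts about T carry the argument
-- (module PathGeometry):
--  * convexity: i_p, …, i_q is a T-path, so by coherence a vertex in the bags
--    of i_p and i_q is in every bag in between;
--  * separation: distinct path nodes lie in distinct components of T − E(P),
--    since a detour in T − E(P) from i_p to i_q (p < q) followed by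
--    i_q, …, i_{p+1} joins the ends of the edge {i_p, i_{p+1}} by another
--    walk, which in an acyclic graph is impossible.
module Submission where

open import Defs hiding (sym)
open import Data.Nat using (ℕ; suc)
open import Data.Fin using (Fin)
open import Data.Sum using (_⊎_)
open import Data.Product using (∃; _×_)
open import Data.Empty using (⊥)
open import Relation.Binary.PropositionalEquality using (_≢_)
open import Data.Nat as ℕ using (zero; _+_; z≤n; s≤s; s≤s⁻¹)
open import Data.Nat.Properties as ℕ
  using (+-suc; +-cancelˡ-≤; +-cancelˡ-≡; ≤-trans; <-≤-trans; n≤1+n; m≢1+m+n; m≤n⇒∃[o]m+o≡n)
open import Data.Fin using (toℕ; fromℕ; fromℕ<; inject₁; _<_; _≤_) renaming (suc to fsuc; zero to fzero)
open import Data.Fin.Properties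
  using (_≟_; <⇒≤pred; ≤̄⇒inject₁<; toℕ-injective; toℕ-fromℕ<; toℕ-inject; toℕ-inject₁; toℕ<n; any?; <-cmp; ¬∀⟶∃¬-smallest)
open import Data.Fin.Subset using (Subset; _∈_; _∉_; _⊆_)
open import Data.Fin.Subset.Properties using (_∈?_)
open import Data.List using (List; []; _∷_; head; last)
open import Data.List.Relation.Unary.All as All using (All; []; _∷_)
open import Data.List.Relation.Unary.All.Properties using (¬Any⇒All¬)
open import Data.List.Relation.Unary.Any as Any using (here; there)
open import Data.List.Relation.Unary.AllPairs using ([]; _∷_)
open import Data.List.Relation.Unary.Unique.Propositional using (Unique)
open import Data.List.Membership.Propositional using (find) renaming (_∈_ to _∈ₗ_)
open import Data.Maybe using (just)
open import Data.Maybe.Properties using (just-injective)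
open import Data.Product using (_,_; proj₁; proj₂)
open import Data.Sum as Sum using (inj₁; inj₂)
open import Data.Empty using (⊥-elim)
open import Data.Unit using (tt)
open import Function using (_∘_)
open import Level using (0ℓ)
open import Relation.Nullary using (¬_; yes; no)
open import Relation.Nullary.Decidable using (_×-dec_; ¬?; decidable-stable)
open import Relation.Unary using (Pred; Decidable)
open import Relation.Binary using (Rel; tri<; tri≈; tri>)
open import Relation.Binary.Construct.Closure.ReflexiveTransitive as Star
  using (Star; ε; _◅_; _◅◅_)
open import Relation.Binary.PropositionalEquality using (_≡_; refl; sym; trans; cong; subst; subst₂)

least-witness : ∀ {k} {Q : Pred (Fin k) 0ℓ} → Decidable Q → ∃ Q →
                ∃ λ h → Q h × (∀ h' → h' < h → ¬ Q h')
least-witness {Q = Q} Q? (w , Qw) with ¬∀⟶∃¬-smallest _ (¬_ ∘ Q) (¬? ∘ Q?) (λ ∀¬Q → ∀¬Q w Qw)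
... | h , ¬¬Qh , below = h , decidable-stable (Q? h) ¬¬Qh , λ h' h'<h →
  subst (¬_ ∘ Q) (toℕ-injective (trans (toℕ-inject _) (toℕ-fromℕ< h'<h))) (below (fromℕ< h'<h))

witness-⊈ : ∀ {n} (A B : Subset n) → ¬ (A ⊆ B) → ∃ λ x → x ∈ A × x ∉ B
witness-⊈ A B A⊈B with any? (λ x → (x ∈? A) ×-dec ¬? (x ∈? B))
... | yes w = w
... | no ¬w = ⊥-elim (A⊈B λ {x} x∈A → decidable-stable (x ∈? B) (λ x∉B → ¬w (x , x∈A , x∉B)))

module _ {m : ℕ} {A : Rel (Fin m) 0ℓ} where

  chain⇒walk : ∀ ps {u v} → Chain A ps → head ps ≡ just u → last ps ≡ just v → Star A u v
  chain⇒walk (x ∷ [])     tt       refl refl = ε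
  chain⇒walk (x ∷ y ∷ ps) (e , ch) refl lt   = e ◅ chain⇒walk (y ∷ ps) ch refl lt

  path⇒walk : ∀ {u v ps} → IsPathBetween A u v ps → Star A u v
  path⇒walk {ps = ps} (ch , _ , hd , lt) = chain⇒walk ps ch hd lt

  suffix-path : ∀ {u v ps} → u ∈ₗ ps → Chain A ps → Unique ps → last ps ≡ just v →
                ∃ λ qs → IsPathBetween A u v qs
  suffix-path {ps = ps}         (here refl) ch       un       lt = ps , ch , un , refl , lt
  suffix-path {ps = _ ∷ _ ∷ _}  (there u∈)  (_ , ch) (_ ∷ un) lt = suffix-path u∈ ch un lt

  -- Loop erasure: every walk contains a path with the same ends.
  walk⇒path : ∀ {u v} → Star A u v → ∃ λ ps → IsPathBetween A u v ps
  walk⇒path {u} ε = (u ∷ []) , tt , ([] ∷ []) , refl , refl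
  walk⇒path {u} (e ◅ w) with walk⇒path w
  ... | (y ∷ ps) , ch , un , refl , lt with Any.any? (u ≟_) (y ∷ ps)
  ...   | yes u∈ = suffix-path u∈ ch un lt
  ...   | no u∉  = (u ∷ y ∷ ps) , (e , ch) , (¬Any⇒All¬ _ u∉ ∷ un) , refl , lt

chain-map : ∀ {m} {A B : Rel (Fin m) 0ℓ} → (∀ {a b} → A a b → B a b) → ∀ ps → Chain A ps → Chain B ps
chain-map f (x ∷ [])     tt       = tt
chain-map f (x ∷ y ∷ ps) (e , ch) = f e , chain-map f (y ∷ ps) ch

Avoiding : ∀ {m} → Graph m → Fin m → Fin m → Rel (Fin m) 0ℓ
Avoiding T u v a b = Adj T a b × ¬ ((a ≡ u × b ≡ v) ⊎ (a ≡ v × b ≡ u))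

avoiding-sym : ∀ {m} (T : Graph m) {u v a b} → Avoiding T u v a b → Avoiding T u v b a
avoiding-sym T (e , ¬uv) = Graph.sym T e , λ
  { (inj₁ (b≡u , a≡v)) → ¬uv (inj₂ (a≡v , b≡u))
  ; (inj₂ (b≡v , a≡u)) → ¬uv (inj₁ (a≡u , b≡v)) }

-- In an acyclic graph the ends of an edge are joined by no other walk:
-- a path from u to v avoiding {u, v} has at least three vertices, and the
-- edge v u closes it into a cycle.
acyclic⇒no-detour : ∀ {m} (T : Graph m) → ¬ HasCycle T → ∀ {u v} → Adj T u v →
                    ¬ Star (Avoiding T u v) u v
acyclic⇒no-detour T acyclic {u} {v} uv w with walk⇒path w
... | (x ∷ [])         , _ , _ , refl , refl = irref T uv
... | (x ∷ y ∷ [])     , ((_ , ¬uv) , _) , _ , refl , refl = ¬uv (inj₁ (refl , refl))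
... | ps@(x ∷ y ∷ z ∷ _) , ch , un , hd , lt =
  acyclic (ps , u , v , (chain-map proj₁ ps ch , un , hd , lt) , s≤s (s≤s (s≤s z≤n)) , Graph.sym T uv)

module _ {m : ℕ} where

  segment : (ℕ → Fin m) → ℕ → List (Fin m)
  segment f zero    = f 0 ∷ []
  segment f (suc d) = f 0 ∷ segment (f ∘ suc) d

  segment-head : ∀ f d → head (segment f d) ≡ just (f 0)
  segment-head f zero    = refl
  segment-head f (suc d) = refl

  segment-last : ∀ f d → last (segment f d) ≡ just (f d)
  segment-last f zero          = refl
  segment-last f (suc zero)    = refl
  segment-last f (suc (suc d)) = segment-last (f ∘ suc) (suc d)

  segment-∈ : ∀ f d c → c ℕ.≤ d → f c ∈ₗ segment f d
  segment-∈ f zero    zero    _       = here refl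
  segment-∈ f (suc d) zero    _       = here refl
  segment-∈ f (suc d) (suc c) (s≤s c≤d) = there (segment-∈ (f ∘ suc) d c c≤d)

  segment-∈⁻ : ∀ f d {y} → y ∈ₗ segment f d → ∃ λ c → c ℕ.≤ d × y ≡ f c
  segment-∈⁻ f zero    (here y≡) = 0 , z≤n , y≡
  segment-∈⁻ f (suc d) (here y≡) = 0 , z≤n , y≡
  segment-∈⁻ f (suc d) (there y∈) with segment-∈⁻ (f ∘ suc) d y∈
  ... | c , c≤d , y≡ = suc c , s≤s c≤d , y≡

  segment-chain : ∀ {A : Rel (Fin m) 0ℓ} f d → (∀ k → k ℕ.< d → A (f k) (f (suc k))) →
                  Chain A (segment f d)
  segment-chain f zero          step = tt
  segment-chain f (suc zero)    step = step 0 (s≤s z≤n) , tt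
  segment-chain f (suc (suc d)) step =
    step 0 (s≤s z≤n) , segment-chain (f ∘ suc) (suc d) (λ k k<d → step (suc k) (s≤s k<d))

  segment-unique : ∀ f d → (∀ c c' → c ℕ.≤ d → c' ℕ.≤ d → f c ≡ f c' → c ≡ c') →
                   Unique (segment f d)
  segment-unique f zero    inj = [] ∷ []
  segment-unique f (suc d) inj =
    All.tabulate first-is-new ∷ segment-unique (f ∘ suc) d λ c c' c≤d c'≤d eq →
      cong ℕ.pred (inj (suc c) (suc c') (s≤s c≤d) (s≤s c'≤d) eq)
    where
    first-is-new : ∀ {y} → y ∈ₗ segment (f ∘ suc) d → f 0 ≢ y
    first-is-new y∈ f0≡y with segment-∈⁻ (f ∘ suc) d y∈
    ... | c , c≤d , refl with inj 0 (suc c) z≤n (s≤s c≤d) f0≡y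
    ...   | ()

module PathGeometry {n m ℓ : ℕ} {G : Graph n} (D : TreeDecomposition G m) (P : PathIn (T D) ℓ) where

  -- The path node i_k as a function of k ∈ ℕ (clamped to i_ℓ beyond ℓ),
  -- so that segments of P are segments of a sequence.
  index : ℕ → Fin (suc ℓ)
  index k with k ℕ.<? suc ℓ
  ... | yes k<1+ℓ = fromℕ< k<1+ℓ
  ... | no _      = fromℕ ℓ

  toℕ-index : ∀ {k} → k ℕ.≤ ℓ → toℕ (index k) ≡ k
  toℕ-index {k} k≤ℓ with k ℕ.<? suc ℓ
  ... | yes k<1+ℓ = toℕ-fromℕ< k<1+ℓ
  ... | no k≮1+ℓ  = ⊥-elim (k≮1+ℓ (s≤s k≤ℓ))

  i : ℕ → Fin m
  i k = node P (index k)

  node≡i : ∀ h → node P h ≡ i (toℕ h)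
  node≡i h = cong (node P) (toℕ-injective (sym (toℕ-index (s≤s⁻¹ (toℕ<n h)))))

  i-injective : ∀ {k k'} → k ℕ.≤ ℓ → k' ℕ.≤ ℓ → i k ≡ i k' → k ≡ k'
  i-injective k≤ℓ k'≤ℓ eq = trans (sym (toℕ-index k≤ℓ)) (trans (cong toℕ (inj P eq)) (toℕ-index k'≤ℓ))

  edge-ends : ∀ {k} (k<ℓ : k ℕ.< ℓ) →
              node P (inject₁ (fromℕ< k<ℓ)) ≡ i k × node P (fsuc (fromℕ< k<ℓ)) ≡ i (suc k)
  edge-ends k<ℓ =
    trans (node≡i _) (cong i (trans (toℕ-inject₁ _) (toℕ-fromℕ< k<ℓ))) ,
    trans (node≡i _) (cong (i ∘ suc) (toℕ-fromℕ< k<ℓ))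

  i-adj : ∀ {k} → k ℕ.< ℓ → Adj (T D) (i k) (i (suc k))
  i-adj k<ℓ with edge-ends k<ℓ
  ... | eq₁ , eq₂ = subst₂ (Adj (T D)) eq₁ eq₂ (adj P (fromℕ< k<ℓ))

  i-path-edge : ∀ {k} → k ℕ.< ℓ → PathEdge D P (i k) (i (suc k))
  i-path-edge k<ℓ = fromℕ< k<ℓ , inj₁ (sym (proj₁ (edge-ends k<ℓ)) , sym (proj₂ (edge-ends k<ℓ)))

  path-edge-sym : ∀ {a b} → PathEdge D P a b → PathEdge D P b a
  path-edge-sym (h , ends) = h , Sum.swap ends

  adj-minus-sym : ∀ {a b} → AdjMinus D P a b → AdjMinus D P b a
  adj-minus-sym (e , ¬pe) = Graph.sym (T D) e , ¬pe ∘ path-edge-sym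

  stretch : ℕ → ℕ → List (Fin m)
  stretch a = segment (λ k → i (a + k))

  stretch-head : ∀ a d → head (stretch a d) ≡ just (i a)
  stretch-head a d = trans (segment-head _ d) (cong (just ∘ i) (ℕ.+-identityʳ a))

  stretch-step : ∀ a {k} → suc (a + k) ℕ.≤ ℓ → Adj (T D) (i (a + k)) (i (a + suc k))
  stretch-step a {k} a+k<ℓ = subst (Adj (T D) (i (a + k)) ∘ i) (sym (+-suc a k)) (i-adj a+k<ℓ)

  stretch-injective : ∀ a d → a + d ℕ.≤ ℓ → ∀ c c' → c ℕ.≤ d → c' ℕ.≤ d → i (a + c) ≡ i (a + c') → c ≡ c'
  stretch-injective a d a+d≤ℓ c c' c≤d c'≤d eq =
    +-cancelˡ-≡ a c c' (i-injective (bound c≤d) (bound c'≤d) eq)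
    where
    bound : ∀ {c} → c ℕ.≤ d → a + c ℕ.≤ ℓ
    bound c≤d = ≤-trans (ℕ.+-monoʳ-≤ a c≤d) a+d≤ℓ

  stretch-path : ∀ a d → a + d ℕ.≤ ℓ → IsPathBetween (Adj (T D)) (i a) (i (a + d)) (stretch a d)
  stretch-path a d a+d≤ℓ =
    segment-chain _ d (λ k k<d → stretch-step a (≤-trans (k-bound k<d) a+d≤ℓ)) ,
    segment-unique _ d (stretch-injective a d a+d≤ℓ) ,
    stretch-head a d ,
    segment-last _ d
    where
    k-bound : ∀ {k} → k ℕ.< d → suc (a + k) ℕ.≤ a + d
    k-bound {k} k<d = subst (ℕ._≤ a + d) (+-suc a k) (ℕ.+-monoʳ-≤ a k<d)

  bag-convex : ∀ {p c q} x → p ℕ.≤ c → c ℕ.≤ q → q ℕ.≤ ℓ →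
               x ∈ X D (i p) → x ∈ X D (i q) → x ∈ X D (i c)
  bag-convex {p} x p≤c c≤q q≤ℓ with m≤n⇒∃[o]m+o≡n p≤c | m≤n⇒∃[o]m+o≡n (≤-trans p≤c c≤q)
  ... | e , refl | d , refl = coherence D _ _ _ (stretch p d) (stretch-path p d q≤ℓ)
    (segment-∈ (λ k → i (p + k)) d e (+-cancelˡ-≤ p e d c≤q)) x

  bag-convex-nodes : ∀ x {h₁ h h₂ : Fin (suc ℓ)} → h₁ ≤ h → h ≤ h₂ →
                     x ∈ X D (node P h₁) → x ∈ X D (node P h₂) → x ∈ X D (node P h)
  bag-convex-nodes x {h₁} {h} {h₂} h₁≤h h≤h₂ x∈h₁ x∈h₂ =
    subst (λ j → x ∈ X D j) (sym (node≡i h))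
      (bag-convex x h₁≤h h≤h₂ (s≤s⁻¹ (toℕ<n h₂))
        (subst (λ j → x ∈ X D j) (node≡i h₁) x∈h₁) (subst (λ j → x ∈ X D j) (node≡i h₂) x∈h₂))

  separate< : ∀ {p q} → p ℕ.< q → q ℕ.≤ ℓ → ¬ Star (AdjMinus D P) (i p) (i q)
  separate< {p} p<q q≤ℓ w with m≤n⇒∃[o]m+o≡n p<q
  ... | d , refl = acyclic⇒no-detour (T D) (proj₂ (isTree D)) (i-adj p<ℓ)
    (Star.map not-that-edge w ◅◅ Star.reverse (avoiding-sym (T D)) back)
    where
    p<ℓ : p ℕ.< ℓ
    p<ℓ = <-≤-trans p<q q≤ℓ
    Avoid : Rel (Fin m) 0ℓ
    Avoid = Avoiding (T D) (i p) (i (suc p))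
    not-that-edge : ∀ {a b} → AdjMinus D P a b → Avoid a b
    not-that-edge (e , ¬pe) = e , λ
      { (inj₁ (refl , refl)) → ¬pe (i-path-edge p<ℓ)
      ; (inj₂ (refl , refl)) → ¬pe (path-edge-sym (i-path-edge p<ℓ)) }
    -- the steps of i_{p+1}, …, i_q avoid {i_p, i_{p+1}}, as P is injective
    later : ∀ k → suc p + k ℕ.≤ ℓ → i (suc p + k) ≢ i p
    later k bound eq = m≢1+m+n p (sym (i-injective bound (≤-trans (n≤1+n p) p<ℓ) eq))
    step : ∀ k → k ℕ.< d → Avoid (i (suc p + k)) (i (suc p + suc k))
    step k k<d = stretch-step (suc p) k-bound , λ
      { (inj₁ (eq , _)) → later k (≤-trans (n≤1+n _) k-bound) eq
      ; (inj₂ (_ , eq)) → later (suc k) (subst (ℕ._≤ ℓ) (sym (+-suc (suc p) k)) k-bound) eq }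
      where
      k-bound : suc (suc p + k) ℕ.≤ ℓ
      k-bound = ≤-trans (subst (ℕ._≤ suc p + d) (+-suc (suc p) k) (ℕ.+-monoʳ-≤ (suc p) k<d)) q≤ℓ
    back : Star Avoid (i (suc p)) (i (suc p + d))
    back = chain⇒walk (stretch (suc p) d) (segment-chain _ d step) (stretch-head (suc p) d) (segment-last _ d)

  separate : ∀ a b → a ≢ b → ¬ Star (AdjMinus D P) (node P a) (node P b)
  separate a b a≢b w with <-cmp a b
  ... | tri< a<b _ _ = separate< a<b (s≤s⁻¹ (toℕ<n b)) (subst₂ (Star _) (node≡i a) (node≡i b) w)
  ... | tri≈ _ a≡b _ = a≢b a≡b
  ... | tri> _ _ b<a = separate< b<a (s≤s⁻¹ (toℕ<n a)) (subst₂ (Star _) (node≡i b) (node≡i a) (Star.reverse adj-minus-sym w))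

  OnPath : Fin m → Set
  OnPath j = ∃ λ h → node P h ≡ j

  on-path? : Decidable OnPath
  on-path? j = any? (λ h → node P h ≟ j)

  off-path-chain : ∀ y ps → Chain (Adj (T D)) (y ∷ ps) → All (¬_ ∘ OnPath) ps →
                   Chain (AdjMinus D P) (y ∷ ps)
  off-path-chain y []       tt       []           = tt
  off-path-chain y (z ∷ ps) (e , ch) (z∉P ∷ off) = (e , not-path-edge) , off-path-chain z ps ch off
    where
    not-path-edge : ¬ PathEdge D P y z
    not-path-edge (h , inj₁ (_ , z≡)) = z∉P (fsuc h , sym z≡)
    not-path-edge (h , inj₂ (z≡ , _)) = z∉P (inject₁ h , sym z≡)

  after-last-path-node : ∀ {j} ps → Chain (Adj (T D)) ps → Unique ps → last ps ≡ just j →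
                         (∃ λ h → InComponent D P (node P h) j) ⊎ All (¬_ ∘ OnPath) ps
  after-last-path-node (y ∷ []) ch un lt with on-path? y
  ... | yes (h , refl) = inj₁ (h , (y ∷ []) , tt , un , refl , lt)
  ... | no y∉P         = inj₂ (y∉P ∷ [])
  after-last-path-node (y ∷ z ∷ ps) (e , ch) (y∉ ∷ un) lt with after-last-path-node (z ∷ ps) ch un lt
  ... | inj₁ found = inj₁ found
  ... | inj₂ off with on-path? y
  ...   | yes (h , refl) = inj₁ (h , (y ∷ z ∷ ps) , off-path-chain y (z ∷ ps) (e , ch) off , (y∉ ∷ un) , refl , lt)
  ...   | no y∉P         = inj₂ (y∉P ∷ off)

module Partition {n m ℓ : ℕ} {G : Graph n} (D : TreeDecomposition G m) (P : PathIn (T D) ℓ) where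
  open PathGeometry D P

  -- Two sets S_{i_a}, S_{i_b} sharing x: a T-path between bags containing x
  -- meets P (so x ∈ R) or joins T_{i_a} and T_{i_b} inside T − E(P).
  S-disjoint : ∀ a b → a ≢ b → ∀ x → InSᵢ D P a x → InSᵢ D P b x → ⊥
  S-disjoint a b a≢b x ((j , (_ , a~j) , x∈j) , x∉R) ((j' , (_ , b~j') , x∈j') , _)
    with proj₁ (isTree D) j j'
  ... | qs , j~j'@(ch , _ , hd , lt) with Any.any? on-path? qs
  ...   | no avoids = separate a b a≢b
    (path⇒walk a~j ◅◅ chain⇒walk qs (minus-chain qs ch (¬Any⇒All¬ qs avoids)) hd lt ◅◅
     Star.reverse adj-minus-sym (path⇒walk b~j'))
    where
    minus-chain : ∀ qs → Chain (Adj (T D)) qs → All (¬_ ∘ OnPath) qs → Chain (AdjMinus D P) qs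
    minus-chain (y ∷ ys) ch (_ ∷ off) = off-path-chain y ys ch off
  ...   | yes meets with find meets
  ...     | _ , k∈qs , (h , refl) = x∉R (h , coherence D j j' _ qs j~j' k∈qs x x∈j x∈j')

  family-disjoint : ∀ (a b : Fin (suc ℓ) ⊎ Fin (suc ℓ)) → a ≢ b → ∀ x → Family D P a x → Family D P b x → ⊥
  family-disjoint (inj₁ a) (inj₁ b) a≢b x (x∈a , before-a) (x∈b , before-b) with <-cmp a b
  ... | tri< a<b _ _ = before-b a a<b x∈a
  ... | tri≈ _ a≡b _ = a≢b (cong inj₁ a≡b)
  ... | tri> _ _ b<a = before-a b b<a x∈b
  family-disjoint (inj₁ a) (inj₂ b) _   x (x∈a , _) (_ , x∉R) = x∉R (a , x∈a)
  family-disjoint (inj₂ a) (inj₁ b) _   x (_ , x∉R) (x∈b , _) = x∉R (b , x∈b)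
  family-disjoint (inj₂ a) (inj₂ b) a≢b x = S-disjoint a b (a≢b ∘ cong inj₂) x

  -- A vertex of R lies in R_i for its path node i; any other vertex lies in
  -- some bag X^j, and j ∈ T_i for the last path node i on the T-path i₀ … j.
  covers : ∀ x → ∃ λ a → Family D P a x
  covers x with any? (λ h → x ∈? X D (node P h))
  ... | yes x∈R with least-witness (λ h → x ∈? X D (node P h)) x∈R
  ...   | h , x∈h , before = inj₁ h , x∈h , before
  covers x | no x∉R with cover-vertices D x
  ... | j , x∈j with proj₁ (isTree D) (node P fzero) j
  ...   | ps , ch , un , hd , lt with after-last-path-node ps ch un lt
  ...     | inj₁ (h , i~j) = inj₂ h , (j , i~j , x∈j) , x∉R
  ...     | inj₂ off      = ⊥-elim (starts-on-path ps hd off)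
    where
    starts-on-path : ∀ ps → head ps ≡ just (node P fzero) → ¬ All (¬_ ∘ OnPath) ps
    starts-on-path (y ∷ _) hd (y∉P ∷ _) = y∉P (fzero , just-injective (sym hd))

  -- R_{i₀} ⊇ X^{i₀} ≠ ∅; a vertex of X^{i_{g+1}} ∖ X^{i_g} is in no earlier
  -- bag, since by convexity it would then be in X^{i_g}.
  R-nonempty : NonredundantEnd D P → ∀ h → ∃ λ x → InRᵢ D P h x
  R-nonempty ((x , x∈) , _) fzero = x , x∈ , λ _ ()
  R-nonempty (_ , new) (fsuc g) with witness-⊈ _ _ (new g)
  ... | x , x∈ , x∉ = x , x∈ , λ h' h'<g+1 x∈h' →
    x∉ (bag-convex-nodes x (<⇒≤pred h'<g+1) (ℕ.<⇒≤ (≤̄⇒inject₁< ℕ.≤-refl)) x∈h' x∈)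

proposition4p3 : {n m ℓ : ℕ} (G : Graph n) (D : TreeDecomposition G m) (P : PathIn (T D) ℓ) →
    NonredundantEnd D P →
    ((∀ (a b : Fin (suc ℓ) ⊎ Fin (suc ℓ)) → a ≢ b → ∀ x → Family D P a x → Family D P b x → ⊥)
    × (∀ x → ∃ λ a → Family D P a x))
    × (∀ (h : Fin (suc ℓ)) → ∃ λ x → InRᵢ D P h x)
proposition4p3 G D P nonredundant = (family-disjoint , covers) , R-nonempty nonredundant
  where open Partition D P
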